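{- Let $n\ge1$, let $x_1,\dots,x_n$ be distinct integers greater than $1$, and let $D=\{1,0,x_1,\dots,x_n\}$. If $(T,s)$ is an optimal signed tree realizing $D$, then there is exactly one edge $e$ of $T$ with $s(e)=-$.
   Context: A signed tree is a pair $(T,s)$ with $T$ a finite tree and $s:E(T)\to\{+,-\}$. The signed degree $sdeg(v)$ of a vertex is the number of incident positive edges minus the number of incident negative edges. $(T,s)$ realizes $D$ if $D=\{sdeg(v):v\in V(T)\}$. $\sigma(D)$ is the minimum number of vertices of a tree $T$ such that some signed tree $(T,s)$ realizes $D$; a signed tree $(T,s)$ realizing $D$ is optimal if $|V(T)|=\sigma(D)$. -}

module Defs where

open import Data.Nat using (ℕ; zero; suc; _≤_)
open import Data.Fin using (Fin; zero; suc; inject₁; fromℕ)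
open import Data.Integer using (ℤ; _+_; _-_; 0ℤ; 1ℤ) renaming (_<_ to _<ℤ_)
open import Data.Maybe using (Maybe; just; nothing)
open import Data.Product using (Σ; ∃; _×_; _,_)
open import Data.Sum using (_⊎_)
open import Relation.Binary.PropositionalEquality using (_≡_)
open import Relation.Binary.Construct.Closure.ReflexiveTransitive using (Star)
open import Relation.Nullary using (¬_)
open import Function.Definitions using (Injective)

data Sign : Set where
  plus minus : Sign

record SignedGraph (m : ℕ) : Set where
  field
    A     : Fin m → Fin m → Maybe Sign
    symm  : ∀ i j → A i j ≡ A j i
    noLoop : ∀ i → A i i ≡ nothing
open SignedGraph public

Adj : ∀ {m} → SignedGraph m → Fin m → Fin m → Set
Adj G i j = ∃ λ (s : Sign) → A G i j ≡ just s

Connected : ∀ {m} → SignedGraph m → Set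
Connected {m} G = ∀ (i j : Fin m) → Star (Adj G) i j

-- A cycle: k+3 distinct vertices c 0, …, c (k+2) with consecutive ones
-- adjacent and c (k+2) adjacent to c 0.
IsCycle : ∀ {m} → SignedGraph m → (k : ℕ) → (Fin (suc (suc (suc k))) → Fin m) → Set
IsCycle G k c =
  Injective _≡_ _≡_ c
  × (∀ (i : Fin (suc (suc k))) → Adj G (c (inject₁ i)) (c (suc i)))
  × Adj G (c (fromℕ (suc (suc k)))) (c zero)

Acyclic : ∀ {m} → SignedGraph m → Set
Acyclic G = ∀ k c → ¬ IsCycle G k c

record SignedTree (m : ℕ) : Set where
  field
    graph     : SignedGraph m
    connected : Connected graph
    acyclic   : Acyclic graph
open SignedTree public

val : Maybe Sign → ℤ
val nothing      = 0ℤ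
val (just plus)  = 1ℤ
val (just minus) = 0ℤ - 1ℤ

sumFin : ∀ m → (Fin m → ℤ) → ℤ
sumFin zero    f = 0ℤ
sumFin (suc m) f = f zero + sumFin m (λ i → f (suc i))

sdeg : ∀ {m} → SignedTree m → Fin m → ℤ
sdeg {m} T v = sumFin m (λ w → val (A (graph T) v w))

Realizes : (ℤ → Set) → ∀ {m} → SignedTree m → Set
Realizes D {m} T = (∀ v → D (sdeg T v)) × (∀ d → D d → ∃ λ (v : Fin m) → sdeg T v ≡ d)

Optimal : (ℤ → Set) → ∀ {m} → SignedTree m → Set
Optimal D {m} T = Realizes D T × (∀ m' (T' : SignedTree m') → Realizes D T' → m ≤ m')

DSet : ∀ {n} → (Fin n → ℤ) → ℤ → Set
DSet {n} x z = z ≡ 1ℤ ⊎ z ≡ 0ℤ ⊎ (∃ λ (i : Fin n) → z ≡ x i)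

ExactlyOneNegEdge : ∀ {m} → SignedTree m → Set
ExactlyOneNegEdge {m} T =
  ∃ λ (a : Fin m) → ∃ λ (b : Fin m) →
    A (graph T) a b ≡ just minus
    × (∀ i j → A (graph T) i j ≡ just minus → (i ≡ a × j ≡ b) ⊎ (i ≡ b × j ≡ a))

{-# OPTIONS --safe #-}
module Submission where

-- In a tree whose signed degrees are all non-negative, a vertex v with q(v) negative edges
-- has degree |sdeg v| + 2 q(v), and degree at least 1 if the tree has two vertices.
-- Summing over the m vertices, whose degrees add up to 2 (m − 1), shows that every tree
-- realizing D has m ≥ 2 + Σᵢ (xᵢ − 1) + Σᵥ q(v).  Conversely, starting from the path + − +
-- and, for each i, attaching xᵢ − 1 positive leaves to the current end of the spine (which
-- thereby gets signed degree xᵢ) and moving the end to one of them, gives a caterpillar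
-- realizing D with Σᵢ (xᵢ − 1) + 4 vertices.  So an optimal tree has Σᵥ q(v) ≤ 2, that is
-- at most one negative edge, while its vertex of signed degree 0 lies on one.

open import Defs
open import Data.Empty using (⊥; ⊥-elim)
open import Data.Fin using (Fin; zero; suc; punchIn; punchOut; toℕ; inject₁; fromℕ; inject≤)
open import Data.Fin.Properties
  using ( any?; ¬∀⟶∃¬; punchIn-punchOut; punchOut-injective; punchInᵢ≢i; punchIn-injective
        ; toℕ-injective; toℕ-inject₁; toℕ-inject≤; toℕ-fromℕ; inject≤-injective; toℕ<n; injective⇒≤ )
  renaming (_≟_ to _≟ᶠ_; suc-injective to Fin-suc-injective)
open import Data.Fin.Relation.Unary.Top using (view; ‵fromℕ; ‵inj₁)
open import Data.Integer as ℤ using (ℤ; +_; -[1+_]; 0ℤ; 1ℤ; ∣_∣; _<_; +≤+; +<+)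
import Data.Integer.Properties as ℤ
open import Data.Integer.Tactic.RingSolver using (solve-∀)
open import Data.Maybe using (Maybe; just; nothing)
open import Data.Nat using (ℕ; zero; suc; _+_; _*_; _∸_; _≤_; _≤?_; z≤n; s≤s; s≤s⁻¹)
open import Data.Nat.Properties
open import Algebra.Properties.CommutativeMonoid.Sum +-0-commutativeMonoid
  using (sum; sum-cong-≗; sum-remove; ∑-distrib-+)
open import Data.Product using (Σ; ∃; _×_; _,_; proj₁; proj₂)
open import Data.Sum using (_⊎_; inj₁; inj₂)
open import Function using (_∘_)
open import Function.Definitions using (Injective)
open import Relation.Binary.Construct.Closure.ReflexiveTransitive using (Star; ε; _◅_; _◅◅_; gmap)
open import Relation.Binary.PropositionalEquality
open import Relation.Nullary using (¬_; yes; no)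
open import Relation.Unary using (_∪_; _⊆_)

sum-mono-≤ : ∀ {n} {f g : Fin n → ℕ} → (∀ i → f i ≤ g i) → sum f ≤ sum g
sum-mono-≤ {zero}  f≤g = z≤n
sum-mono-≤ {suc n} f≤g = +-mono-≤ (f≤g zero) (sum-mono-≤ (f≤g ∘ suc))

sum-one : ∀ n → sum {n} (λ _ → 1) ≡ n
sum-one zero    = refl
sum-one (suc n) = cong suc (sum-one n)

f≤sum : ∀ {n} (f : Fin n → ℕ) i → f i ≤ sum f
f≤sum {suc n} f i = subst (f i ≤_) (sym (sum-remove f)) (m≤m+n (f i) _)

f+f≤sum : ∀ {n} (f : Fin n → ℕ) {i j} → i ≢ j → f i + f j ≤ sum f
f+f≤sum {suc n} f {i} {j} i≢j = begin
  f i + f j                  ≡⟨ cong (λ a → f i + f a) (punchIn-punchOut i≢j) ⟨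
  f i + f (punchIn i j′)     ≤⟨ +-monoʳ-≤ (f i) (f≤sum (f ∘ punchIn i) j′) ⟩
  f i + sum (f ∘ punchIn i)  ≡⟨ sum-remove f ⟨
  sum f                      ∎
  where
  open ≤-Reasoning
  j′ = punchOut i≢j

f+f+f≤sum : ∀ {n} (f : Fin n → ℕ) {i j k} → i ≢ j → i ≢ k → j ≢ k → f i + (f j + f k) ≤ sum f
f+f+f≤sum {suc n} f {i} {j} {k} i≢j i≢k j≢k = begin
  f i + (f j + f k)
    ≡⟨ cong₂ (λ a b → f i + (f a + f b)) (punchIn-punchOut i≢j) (punchIn-punchOut i≢k) ⟨
  f i + (f (punchIn i j′) + f (punchIn i k′))
    ≤⟨ +-monoʳ-≤ (f i) (f+f≤sum (f ∘ punchIn i) (j≢k ∘ punchOut-injective i≢j i≢k)) ⟩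
  f i + sum (f ∘ punchIn i)
    ≡⟨ sum-remove f ⟨
  sum f ∎
  where
  open ≤-Reasoning
  j′ = punchOut i≢j
  k′ = punchOut i≢k

sum-∘-injective-≤ : ∀ {k n} (f : Fin n → ℕ) {φ : Fin k → Fin n} → Injective _≡_ _≡_ φ →
                    sum (f ∘ φ) ≤ sum f
sum-∘-injective-≤ {zero}          f     _ = z≤n
sum-∘-injective-≤ {suc k} {zero}  f {φ} _ with φ zero
... | ()
sum-∘-injective-≤ {suc k} {suc n} f {φ} φ-inj = begin
  f (φ zero) + sum (f ∘ φ ∘ suc)
    ≡⟨ cong (λ s → f (φ zero) + s) (sum-cong-≗ (cong f ∘ sym ∘ punchIn-punchOut ∘ φ₀≢φₛ)) ⟩
  f (φ zero) + sum (f ∘ punchIn (φ zero) ∘ ψ)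
    ≤⟨ +-monoʳ-≤ (f (φ zero)) (sum-∘-injective-≤ (f ∘ punchIn (φ zero)) ψ-inj) ⟩
  f (φ zero) + sum (f ∘ punchIn (φ zero))
    ≡⟨ sum-remove f ⟨
  sum f ∎
  where
  open ≤-Reasoning
  φ₀≢φₛ : ∀ i → φ zero ≢ φ (suc i)
  φ₀≢φₛ i eq with φ-inj eq
  ... | ()
  ψ : Fin k → Fin n
  ψ i = punchOut (φ₀≢φₛ i)
  ψ-inj : Injective _≡_ _≡_ ψ
  ψ-inj {i} {j} eq = Fin-suc-injective (φ-inj (punchOut-injective (φ₀≢φₛ i) (φ₀≢φₛ j) eq))

1≤sum⇒∃1≤f : ∀ {n} (f : Fin n → ℕ) → 1 ≤ sum f → ∃ λ i → 1 ≤ f i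
1≤sum⇒∃1≤f {suc n} f 1≤Σ with f zero in eq
... | suc _ = zero , subst (1 ≤_) (sym eq) (s≤s z≤n)
... | zero  with 1≤sum⇒∃1≤f (f ∘ suc) 1≤Σ
...   | i , 1≤fᵢ = suc i , 1≤fᵢ

isEdge isPos isNeg : Maybe Sign → ℕ
isEdge nothing     = 0
isEdge (just _)    = 1
isPos (just plus)  = 1
isPos _            = 0
isNeg (just minus) = 1
isNeg _            = 0

isEdge≤1 : ∀ e → isEdge e ≤ 1
isEdge≤1 nothing  = z≤n
isEdge≤1 (just _) = s≤s z≤n

isEdge≡isPos+isNeg : ∀ e → isEdge e ≡ isPos e + isNeg e
isEdge≡isPos+isNeg nothing      = refl
isEdge≡isPos+isNeg (just plus)  = refl
isEdge≡isPos+isNeg (just minus) = refl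

module _ {m} (G : SignedGraph m) where

  degree posDegree negDegree : Fin m → ℕ
  degree    v = sum (isEdge ∘ A G v)
  posDegree v = sum (isPos ∘ A G v)
  negDegree v = sum (isNeg ∘ A G v)

  degree≡posDegree+negDegree : ∀ v → degree v ≡ posDegree v + negDegree v
  degree≡posDegree+negDegree v =
    trans (sum-cong-≗ (isEdge≡isPos+isNeg ∘ A G v)) (∑-distrib-+ (isPos ∘ A G v) (isNeg ∘ A G v))

  Adj-sym : ∀ {i j} → Adj G i j → Adj G j i
  Adj-sym {i} {j} (s , eq) = s , trans (symm G j i) eq

  Adj-irrefl : ∀ {i j} → Adj G i j → i ≢ j
  Adj-irrefl {i} (s , eq) refl with trans (sym (noLoop G i)) eq
  ... | ()

  Adj⇒1≤degree : ∀ {i j} → Adj G i j → 1 ≤ degree i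
  Adj⇒1≤degree {i} {j} (s , eq) =
    ≤-trans (subst (λ e → 1 ≤ isEdge e) (sym eq) ≤-refl) (f≤sum (isEdge ∘ A G i) j)

  1≤isEdge⇒Adj : ∀ {i j} → 1 ≤ isEdge (A G i j) → Adj G i j
  1≤isEdge⇒Adj {i} {j} 1≤e with A G i j
  ... | just s = s , refl

  walk⇒1≤degree : ∀ {v w} → Star (Adj G) v w → v ≢ w → 1 ≤ degree v
  walk⇒1≤degree ε         v≢v = ⊥-elim (v≢v refl)
  walk⇒1≤degree (adj ◅ _) _   = Adj⇒1≤degree adj

  IsPath : ∀ k → (Fin (suc k) → Fin m) → Set
  IsPath k p = Injective _≡_ _≡_ p × (∀ i → Adj G (p (inject₁ i)) (p (suc i)))

  path+chord⇒cycle : ∀ {k p} → IsPath (suc k) p → (j : Fin k) → Adj G (p (suc (suc j))) (p zero) →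
                     IsCycle G (toℕ j) (λ s → p (inject≤ s (s≤s (s≤s (toℕ<n j)))))
  path+chord⇒cycle {p = p} (p-inj , p-adj) j chord = c-inj , c-adj , c-close
    where
    le  = s≤s (s≤s (toℕ<n j))
    le′ = s≤s (toℕ<n j)
    c-inj : Injective _≡_ _≡_ (λ s → p (inject≤ s le))
    c-inj {a} {b} eq = inject≤-injective le le a b (p-inj eq)
    c-adj : ∀ i → Adj G (p (inject≤ (inject₁ i) le)) (p (inject≤ (suc i) le))
    c-adj i = subst (λ z → Adj G (p z) (p (inject≤ (suc i) le))) inject-comm (p-adj (inject≤ i le′))
      where
      inject-comm : inject₁ (inject≤ i le′) ≡ inject≤ (inject₁ i) le
      inject-comm = toℕ-injective (begin
        toℕ (inject₁ (inject≤ i le′)) ≡⟨ toℕ-inject₁ _ ⟩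
        toℕ (inject≤ i le′)           ≡⟨ toℕ-inject≤ i le′ ⟩
        toℕ i                         ≡⟨ toℕ-inject₁ i ⟨
        toℕ (inject₁ i)               ≡⟨ toℕ-inject≤ (inject₁ i) le ⟨
        toℕ (inject≤ (inject₁ i) le)  ∎)
        where open ≡-Reasoning
    c-close : Adj G (p (inject≤ (fromℕ (suc (suc (toℕ j)))) le)) (p zero)
    c-close = subst (λ z → Adj G (p z) (p zero)) (sym last≡) chord
      where
      last≡ : inject≤ (fromℕ (suc (suc (toℕ j)))) le ≡ suc (suc j)
      last≡ = toℕ-injective (trans (toℕ-inject≤ _ le) (toℕ-fromℕ _))

-- In an acyclic graph of minimum degree 2, a path can be extended at its head p zero by a
-- neighbour other than p (suc zero) that is not yet on the path (else there is a cycle), so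
-- injective paths would outgrow the vertex set.
module _ {M} (G : SignedGraph (suc M)) (acyclic : Acyclic G) (2≤degree : ∀ v → 2 ≤ degree G v) where

  neighbourOtherThan : ∀ v u → ∃ λ y → y ≢ u × Adj G v y
  neighbourOtherThan v u with 1≤sum⇒∃1≤f (isEdge ∘ A G v ∘ punchIn u) 1≤rest
    where
    1≤rest : 1 ≤ sum (isEdge ∘ A G v ∘ punchIn u)
    1≤rest = +-cancelˡ-≤ 1 1 _ (begin
      2                                                   ≤⟨ 2≤degree v ⟩
      degree G v                                          ≡⟨ sum-remove (isEdge ∘ A G v) ⟩
      isEdge (A G v u) + sum (isEdge ∘ A G v ∘ punchIn u) ≤⟨ +-monoˡ-≤ _ (isEdge≤1 (A G v u)) ⟩
      1 + sum (isEdge ∘ A G v ∘ punchIn u)                ∎)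
      where open ≤-Reasoning
  ... | i , 1≤e = punchIn u i , punchInᵢ≢i u i , 1≤isEdge⇒Adj G 1≤e

  ¬IsPath : ∀ fuel k → suc M ≤ suc (suc k) + fuel → ∀ {p} → ¬ IsPath G (suc k) p
  ¬IsPath fuel k bound {p} (p-inj , p-adj) with neighbourOtherThan (p zero) (p (suc zero))
  ... | y , y≢p₁ , p₀~y with any? (λ j → y ≟ᶠ p j)
  ...   | yes (zero , y≡p₀)        = Adj-irrefl G p₀~y (sym y≡p₀)
  ...   | yes (suc zero , y≡p₁)    = y≢p₁ y≡p₁
  ...   | yes (suc (suc j) , y≡pⱼ) =
          acyclic _ _ (path+chord⇒cycle G (p-inj , p-adj) j
                                        (subst (λ z → Adj G z (p zero)) y≡pⱼ (Adj-sym G p₀~y)))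
  ...   | no y∉p = continue fuel bound
    where
    q : Fin (suc (suc (suc k))) → Fin (suc M)
    q zero    = y
    q (suc i) = p i
    q-inj : Injective _≡_ _≡_ q
    q-inj {zero}  {zero}  _  = refl
    q-inj {zero}  {suc b} eq = ⊥-elim (y∉p (b , eq))
    q-inj {suc a} {zero}  eq = ⊥-elim (y∉p (a , sym eq))
    q-inj {suc a} {suc b} eq = cong suc (p-inj eq)
    q-adj : ∀ i → Adj G (q (inject₁ i)) (q (suc i))
    q-adj zero    = Adj-sym G p₀~y
    q-adj (suc i) = p-adj i
    continue : ∀ fuel → suc M ≤ suc (suc k) + fuel → ⊥
    continue zero    bound =
      <⇒≱ (n<1+n _) (≤-trans (injective⇒≤ q-inj) (subst (suc M ≤_) (+-identityʳ _) bound))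
    continue (suc f) bound = ¬IsPath f (suc k) (subst (suc M ≤_) (+-suc _ f) bound) (q-inj , q-adj)

acyclic⇒∃degree≤1 : ∀ {M} (G : SignedGraph (suc M)) → Acyclic G → ∃ λ v → degree G v ≤ 1
acyclic⇒∃degree≤1 {M} G acyclic
  with ¬∀⟶∃¬ (suc M) (λ v → 2 ≤ degree G v) (λ v → 2 ≤? degree G v) minDegree2⇒⊥
  where
  minDegree2⇒⊥ : (∀ v → 2 ≤ degree G v) → ⊥
  minDegree2⇒⊥ 2≤degree with neighbourOtherThan G acyclic 2≤degree zero zero
  ... | y , y≢0 , 0~y = ¬IsPath G acyclic 2≤degree M 0 (n≤1+n _) (p-inj , λ { zero → Adj-sym G 0~y })
    where
    p : Fin 2 → Fin (suc M)
    p zero       = y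
    p (suc zero) = zero
    p-inj : Injective _≡_ _≡_ p
    p-inj {zero}     {zero}     _  = refl
    p-inj {zero}     {suc zero} eq = ⊥-elim (y≢0 eq)
    p-inj {suc zero} {zero}     eq = ⊥-elim (y≢0 (sym eq))
    p-inj {suc zero} {suc zero} _  = refl
... | v , degree≱2 = v , s≤s⁻¹ (≰⇒> degree≱2)

_∖_ : ∀ {M} → SignedGraph (suc M) → Fin (suc M) → SignedGraph M
G ∖ v = record
  { A      = λ i j → A G (punchIn v i) (punchIn v j)
  ; symm   = λ i j → symm G (punchIn v i) (punchIn v j)
  ; noLoop = λ i → noLoop G (punchIn v i)
  }

∖-acyclic : ∀ {M} (G : SignedGraph (suc M)) v → Acyclic G → Acyclic (G ∖ v)
∖-acyclic G v acyclic k c (c-inj , c-adj , c-close) =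
  acyclic k (punchIn v ∘ c) (c-inj ∘ punchIn-injective v _ _ , c-adj , c-close)

acyclic⇒sum-degree≤2*pred : ∀ M (G : SignedGraph (suc M)) → Acyclic G → sum (degree G) ≤ 2 * M
acyclic⇒sum-degree≤2*pred zero    G _ rewrite noLoop G zero = z≤n
acyclic⇒sum-degree≤2*pred (suc M) G acyclic with acyclic⇒∃degree≤1 G acyclic
... | v , degree≤1 = begin
  sum (degree G)
    ≡⟨ sum-remove (degree G) ⟩
  d + sum (degree G ∘ punchIn v)
    ≡⟨ cong (λ s → d + s) (sum-cong-≗ degree-punchIn) ⟩
  d + sum (λ i → toV i + degree (G ∖ v) i)
    ≡⟨ cong (λ s → d + s) (∑-distrib-+ toV (degree (G ∖ v))) ⟩
  d + (sum toV + sum (degree (G ∖ v)))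
    ≡⟨ cong (λ e → d + (e + sum (degree (G ∖ v)))) sum-toV ⟩
  d + (d + sum (degree (G ∖ v)))
    ≤⟨ +-mono-≤ degree≤1 (+-mono-≤ degree≤1 sum-degree-∖) ⟩
  1 + (1 + 2 * M)
    ≡⟨ *-suc 2 M ⟨
  2 * suc M ∎
  where
  open ≤-Reasoning
  d = degree G v
  toV : Fin (suc M) → ℕ
  toV i = isEdge (A G v (punchIn v i))
  degree-punchIn : ∀ i → degree G (punchIn v i) ≡ toV i + degree (G ∖ v) i
  degree-punchIn i = trans (sum-remove (isEdge ∘ A G (punchIn v i)))
                           (cong (λ e → isEdge e + degree (G ∖ v) i) (symm G (punchIn v i) v))
  sum-toV : sum toV ≡ d
  sum-toV = sym (trans (sum-remove (isEdge ∘ A G v)) (cong (λ e → isEdge e + sum toV) (noLoop G v)))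
  sum-degree-∖ : sum (degree (G ∖ v)) ≤ 2 * M
  sum-degree-∖ = acyclic⇒sum-degree≤2*pred M (G ∖ v) (∖-acyclic G v acyclic)

module _ {m} (G : SignedGraph m) where

  1≤isNeg⇒minus : ∀ {e} → 1 ≤ isNeg e → e ≡ just minus
  1≤isNeg⇒minus {just minus} _ = refl

  minus-sym : ∀ {v w} → A G v w ≡ just minus → A G w v ≡ just minus
  minus-sym {v} {w} vw⁻ = trans (symm G w v) vw⁻

  minus-irrefl : ∀ {v w} → A G v w ≡ just minus → v ≢ w
  minus-irrefl vw⁻ = Adj-irrefl G (minus , vw⁻)

  minus⇒1≤negDegree : ∀ {v w} → A G v w ≡ just minus → 1 ≤ negDegree G v
  minus⇒1≤negDegree {v} {w} vw⁻ =
    ≤-trans (≤-reflexive (cong isNeg (sym vw⁻))) (f≤sum (isNeg ∘ A G v) w)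

  minus²⇒2≤negDegree : ∀ {v w w′} → w ≢ w′ → A G v w ≡ just minus → A G v w′ ≡ just minus →
                       2 ≤ negDegree G v
  minus²⇒2≤negDegree {v} {w} {w′} w≢w′ vw⁻ vw′⁻ =
    ≤-trans (≤-reflexive (cong₂ (λ e e′ → isNeg e + isNeg e′) (sym vw⁻) (sym vw′⁻)))
            (f+f≤sum (isNeg ∘ A G v) w≢w′)

  module _ (∑negDegree≤2 : sum (negDegree G) ≤ 2) {a b} (ab⁻ : A G a b ≡ just minus) where

    private
      3≤∑negDegree⇒⊥ : ∀ {k} → 3 ≤ k → k ≤ sum (negDegree G) → ⊥
      3≤∑negDegree⇒⊥ 3≤k k≤∑ = <⇒≱ (≤-trans 3≤k k≤∑) ∑negDegree≤2

    minus-from-a⇒to-b : ∀ {j} → A G a j ≡ just minus → j ≡ b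
    minus-from-a⇒to-b {j} aj⁻ with j ≟ᶠ b
    ... | yes j≡b = j≡b
    ... | no  j≢b = ⊥-elim (3≤∑negDegree⇒⊥
      (+-mono-≤ (minus²⇒2≤negDegree (j≢b ∘ sym) ab⁻ aj⁻) (minus⇒1≤negDegree (minus-sym ab⁻)))
      (f+f≤sum (negDegree G) (minus-irrefl ab⁻)))

    minus⇒incident : ∀ {i j} → A G i j ≡ just minus → i ≡ a ⊎ i ≡ b
    minus⇒incident {i} ij⁻ with i ≟ᶠ a | i ≟ᶠ b
    ... | yes i≡a | _       = inj₁ i≡a
    ... | no  _   | yes i≡b = inj₂ i≡b
    ... | no  i≢a | no  i≢b = ⊥-elim (3≤∑negDegree⇒⊥
      (+-mono-≤ (minus⇒1≤negDegree ab⁻)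
                (+-mono-≤ (minus⇒1≤negDegree (minus-sym ab⁻)) (minus⇒1≤negDegree ij⁻)))
      (f+f+f≤sum (negDegree G) (minus-irrefl ab⁻) (i≢a ∘ sym) (i≢b ∘ sym)))

  ∑negDegree≤2⇒minus-unique : sum (negDegree G) ≤ 2 → ∀ {a b} → A G a b ≡ just minus →
                              ∀ i j → A G i j ≡ just minus → (i ≡ a × j ≡ b) ⊎ (i ≡ b × j ≡ a)
  ∑negDegree≤2⇒minus-unique ∑≤2 ab⁻ i j ij⁻ with minus⇒incident ∑≤2 ab⁻ ij⁻
  ... | inj₁ refl = inj₁ (refl , minus-from-a⇒to-b ∑≤2 ab⁻ ij⁻)
  ... | inj₂ refl = inj₂ (refl , minus-from-a⇒to-b ∑≤2 (minus-sym ab⁻) ij⁻)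

val≡isPos-isNeg : ∀ e → val e ≡ + isPos e ℤ.- + isNeg e
val≡isPos-isNeg nothing      = refl
val≡isPos-isNeg (just plus)  = refl
val≡isPos-isNeg (just minus) = refl

[a-b]+[c-d]≡[a+c]-[b+d] : ∀ a b c d → (a ℤ.- b) ℤ.+ (c ℤ.- d) ≡ (a ℤ.+ c) ℤ.- (b ℤ.+ d)
[a-b]+[c-d]≡[a+c]-[b+d] = solve-∀

sumFin-val : ∀ m (row : Fin m → Maybe Sign) →
             sumFin m (val ∘ row) ≡ + sum (isPos ∘ row) ℤ.- + sum (isNeg ∘ row)
sumFin-val zero    row = refl
sumFin-val (suc m) row = begin
  val (row zero) ℤ.+ sumFin m (val ∘ row ∘ suc)
    ≡⟨ cong₂ ℤ._+_ (val≡isPos-isNeg (row zero)) (sumFin-val m (row ∘ suc)) ⟩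
  (+ p₀ ℤ.- + q₀) ℤ.+ (+ p ℤ.- + q)
    ≡⟨ [a-b]+[c-d]≡[a+c]-[b+d] (+ p₀) (+ q₀) (+ p) (+ q) ⟩
  (+ p₀ ℤ.+ + p) ℤ.- (+ q₀ ℤ.+ + q)
    ≡⟨ cong₂ ℤ._-_ (ℤ.pos-+ p₀ p) (ℤ.pos-+ q₀ q) ⟨
  + (p₀ + p) ℤ.- + (q₀ + q) ∎
  where
  open ≡-Reasoning
  p₀ = isPos (row zero)
  q₀ = isNeg (row zero)
  p  = sum (isPos ∘ row ∘ suc)
  q  = sum (isNeg ∘ row ∘ suc)

sdeg≡posDegree-negDegree : ∀ {m} (T : SignedTree m) v →
                           sdeg T v ≡ + posDegree (graph T) v ℤ.- + negDegree (graph T) v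
sdeg≡posDegree-negDegree {m} T v = sumFin-val m (A (graph T) v)

∣+m-+n∣+n≡m : ∀ {m n} → n ≤ m → ∣ + m ℤ.- + n ∣ + n ≡ m
∣+m-+n∣+n≡m {m} {n} n≤m = begin
  ∣ + m ℤ.- + n ∣ + n ≡⟨ cong (λ i → ∣ i ∣ + n) (trans (ℤ.[+m]-[+n]≡m⊖n m n) (ℤ.⊖-≥ n≤m)) ⟩
  m ∸ n + n           ≡⟨ m∸n+n≡m n≤m ⟩
  m                   ∎
  where open ≡-Reasoning

degree≡∣sdeg∣+negDegree+negDegree : ∀ {m} (T : SignedTree m) v → 0ℤ ℤ.≤ sdeg T v →
  degree (graph T) v ≡ ∣ sdeg T v ∣ + negDegree (graph T) v + negDegree (graph T) v
degree≡∣sdeg∣+negDegree+negDegree T v 0≤sdeg = begin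
  degree G v               ≡⟨ degree≡posDegree+negDegree G v ⟩
  p + q                    ≡⟨ cong (_+ q) (∣+m-+n∣+n≡m q≤p) ⟨
  ∣ + p ℤ.- + q ∣ + q + q  ≡⟨ cong (λ i → ∣ i ∣ + q + q) (sdeg≡posDegree-negDegree T v) ⟨
  ∣ sdeg T v ∣ + q + q     ∎
  where
  open ≡-Reasoning
  G = graph T
  p = posDegree G v
  q = negDegree G v
  q≤p : q ≤ p
  q≤p = ℤ.drop‿+≤+ (ℤ.0≤i-j⇒j≤i (subst (0ℤ ℤ.≤_) (sdeg≡posDegree-negDegree T v) 0≤sdeg))

connected⇒1≤degree : ∀ {m} (T : SignedTree m) {u v} → u ≢ v → ∀ w → 1 ≤ degree (graph T) w
connected⇒1≤degree T {u} {v} u≢v w with w ≟ᶠ u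
... | yes refl = walk⇒1≤degree (graph T) (connected T w v) u≢v
... | no  w≢u  = walk⇒1≤degree (graph T) (connected T w u) w≢u

sdeg≡0⇒∃minus : ∀ {m} (T : SignedTree m) {v} → sdeg T v ≡ 0ℤ → 1 ≤ degree (graph T) v →
                ∃ λ w → A (graph T) v w ≡ just minus
sdeg≡0⇒∃minus T {v} sdeg≡0 1≤degree
  with 1≤sum⇒∃1≤f (isNeg ∘ A (graph T) v) (1≤q+q⇒1≤q (subst (1 ≤_) degree≡q+q 1≤degree))
  where
  q = negDegree (graph T) v
  degree≡q+q : degree (graph T) v ≡ q + q
  degree≡q+q = trans (degree≡∣sdeg∣+negDegree+negDegree T v (ℤ.≤-reflexive (sym sdeg≡0)))
                     (cong (λ i → ∣ i ∣ + q + q) sdeg≡0)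
  1≤q+q⇒1≤q : ∀ {k} → 1 ≤ k + k → 1 ≤ k
  1≤q+q⇒1≤q {suc _} _ = s≤s z≤n
... | w , 1≤isNeg = w , 1≤isNeg⇒minus (graph T) 1≤isNeg

excess : ∀ {k} → (Fin k → ℤ) → ℕ
excess f = sum (λ i → ∣ f i ∣ ∸ 1)

suc[s∸1+q]≤s+q+q : ∀ s q → 1 ≤ s + q + q → suc (s ∸ 1 + q) ≤ s + q + q
suc[s∸1+q]≤s+q+q zero    (suc q) _ = s≤s (m≤n+m (suc q) q)
suc[s∸1+q]≤s+q+q (suc s) q       _ = s≤s (m≤m+n (s + q) q)

nonnegative⇒2+excess+∑negDegree≤size :
  ∀ {M} (T : SignedTree (suc M)) → (∀ v → 1 ≤ degree (graph T) v) → (∀ v → 0ℤ ℤ.≤ sdeg T v) →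
  2 + (excess (sdeg T) + sum (negDegree (graph T))) ≤ suc M
nonnegative⇒2+excess+∑negDegree≤size {M} T 1≤degree 0≤sdeg = s≤s (+-cancelˡ-≤ M _ _ (begin
  M + suc (E + Q)                                  ≡⟨ +-suc M (E + Q) ⟩
  suc M + (E + Q)                                  ≡⟨ cong₂ _+_ (sum-one (suc M)) (∑-distrib-+ e q) ⟨
  sum {suc M} (λ _ → 1) + sum (λ v → e v + q v)   ≡⟨ ∑-distrib-+ (λ _ → 1) (λ v → e v + q v) ⟨
  sum (λ v → suc (e v + q v))                      ≤⟨ sum-mono-≤ suc[e+q]≤degree ⟩
  sum (degree G)                                   ≤⟨ acyclic⇒sum-degree≤2*pred M G (acyclic T) ⟩
  2 * M                                            ≡⟨ cong (λ k → M + k) (+-identityʳ M) ⟩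
  M + M                                            ∎))
  where
  open ≤-Reasoning
  G = graph T
  e : Fin (suc M) → ℕ
  e v = ∣ sdeg T v ∣ ∸ 1
  q = negDegree G
  E = excess (sdeg T)
  Q = sum q
  suc[e+q]≤degree : ∀ v → suc (e v + q v) ≤ degree G v
  suc[e+q]≤degree v rewrite degree≡∣sdeg∣+negDegree+negDegree T v (0≤sdeg v) =
    suc[s∸1+q]≤s+q+q ∣ sdeg T v ∣ (q v)
      (subst (1 ≤_) (degree≡∣sdeg∣+negDegree+negDegree T v (0≤sdeg v)) (1≤degree v))

HasTwoNeighbours : ∀ {m} → SignedGraph m → Fin m → Set
HasTwoNeighbours G v = ∃ λ u → ∃ λ u′ → u ≢ u′ × Adj G v u × Adj G v u′

IsCycle⇒HasTwoNeighbours : ∀ {m} (G : SignedGraph m) {k c} → IsCycle G k c →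
                           ∀ t → HasTwoNeighbours G (c t)
IsCycle⇒HasTwoNeighbours G {k} {c} (c-inj , c-adj , c-close) zero =
  c (suc zero) , c (fromℕ (suc (suc k))) , (λ eq → 1≢last (c-inj eq)) , c-adj zero , Adj-sym G c-close
  where
  1≢last : suc zero ≢ fromℕ (suc (suc k))
  1≢last ()
IsCycle⇒HasTwoNeighbours G {k} {c} (c-inj , c-adj , c-close) (suc t) with view t
... | ‵fromℕ = c (inject₁ t) , c zero , (λ eq → pred≢0 (c-inj eq)) , Adj-sym G (c-adj t) , c-close
  where
  pred≢0 : inject₁ t ≢ zero
  pred≢0 ()
... | ‵inj₁ {i = l} _ =
  c (inject₁ t) , c (suc (suc l)) , (λ eq → pred≢succ (c-inj eq)) , Adj-sym G (c-adj t) , c-adj (suc l)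
  where
  pred≢succ : inject₁ (inject₁ l) ≢ suc (suc l)
  pred≢succ eq = <⇒≢ (m≤n+m (suc (toℕ l)) 1)
    (trans (sym (trans (toℕ-inject₁ (inject₁ l)) (toℕ-inject₁ l))) (cong toℕ eq))

edgeTo : ∀ {m} → Fin m → Sign → Fin m → Maybe Sign
edgeTo zero    s zero    = just s
edgeTo zero    s (suc _) = nothing
edgeTo (suc v) s zero    = nothing
edgeTo (suc v) s (suc j) = edgeTo v s j

edgeTo-self : ∀ {m} (v : Fin m) s → edgeTo v s v ≡ just s
edgeTo-self zero    s = refl
edgeTo-self (suc v) s = edgeTo-self v s

edgeTo-just : ∀ {m} (v : Fin m) {s s′} j → edgeTo v s j ≡ just s′ → j ≡ v
edgeTo-just zero    zero    _  = refl
edgeTo-just (suc v) (suc j) eq = cong suc (edgeTo-just v j eq)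

edgeTo-other : ∀ {m} (v : Fin m) s {j} → j ≢ v → edgeTo v s j ≡ nothing
edgeTo-other zero    s {zero}  j≢v = ⊥-elim (j≢v refl)
edgeTo-other zero    s {suc j} _   = refl
edgeTo-other (suc v) s {zero}  _   = refl
edgeTo-other (suc v) s {suc j} j≢v = edgeTo-other v s (j≢v ∘ cong suc)

sumFin-zero : ∀ m → sumFin m (λ _ → 0ℤ) ≡ 0ℤ
sumFin-zero zero    = refl
sumFin-zero (suc m) = trans (ℤ.+-identityˡ _) (sumFin-zero m)

sumFin-val-edgeTo : ∀ {m} (v : Fin m) s → sumFin m (val ∘ edgeTo v s) ≡ val (just s)
sumFin-val-edgeTo {suc m} zero    s =
  trans (cong (λ z → val (just s) ℤ.+ z) (sumFin-zero m)) (ℤ.+-identityʳ _)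
sumFin-val-edgeTo {suc m} (suc v) s = trans (ℤ.+-identityˡ _) (sumFin-val-edgeTo v s)

addLeafGraph : ∀ {m} → SignedGraph m → Fin m → Sign → SignedGraph (suc m)
addLeafGraph {m} G v s = record { A = A′ ; symm = symm′ ; noLoop = noLoop′ }
  where
  A′ : Fin (suc m) → Fin (suc m) → Maybe Sign
  A′ zero    zero    = nothing
  A′ zero    (suc j) = edgeTo v s j
  A′ (suc i) zero    = edgeTo v s i
  A′ (suc i) (suc j) = A G i j
  symm′ : ∀ i j → A′ i j ≡ A′ j i
  symm′ zero    zero    = refl
  symm′ zero    (suc j) = refl
  symm′ (suc i) zero    = refl
  symm′ (suc i) (suc j) = symm G i j
  noLoop′ : ∀ i → A′ i i ≡ nothing
  noLoop′ zero    = refl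
  noLoop′ (suc i) = noLoop G i

module _ {m} (T : SignedTree m) (v : Fin m) (s : Sign) where

  private
    G  = graph T
    G′ = addLeafGraph G v s

    leaf~v : Adj G′ zero (suc v)
    leaf~v = s , edgeTo-self v s

    leaf-neighbour : ∀ {y} → Adj G′ zero y → y ≡ suc v
    leaf-neighbour {suc j} (_ , eq) = cong suc (edgeTo-just v j eq)

    lift : ∀ {i j} → Star (Adj G) i j → Star (Adj G′) (suc i) (suc j)
    lift = gmap suc (λ adj → adj)

    connected′ : Connected G′
    connected′ zero    zero    = ε
    connected′ zero    (suc j) = leaf~v ◅ lift (connected T v j)
    connected′ (suc i) zero    = lift (connected T i v) ◅◅ (Adj-sym G′ {zero} {suc v} leaf~v ◅ ε)
    connected′ (suc i) (suc j) = lift (connected T i j)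

    acyclic′ : Acyclic G′
    acyclic′ k c cycle with any? (λ t → c t ≟ᶠ zero)
    ... | yes (t , cₜ≡0) with IsCycle⇒HasTwoNeighbours G′ cycle t
    ...   | y , y′ , y≢y′ , cₜ~y , cₜ~y′ =
            y≢y′ (trans (leaf-neighbour (subst (λ z → Adj G′ z y) cₜ≡0 cₜ~y))
                        (sym (leaf-neighbour (subst (λ z → Adj G′ z y′) cₜ≡0 cₜ~y′))))
    acyclic′ k c (c-inj , c-adj , c-close) | no c≢0 =
      acyclic T k c′ (c′-inj , (λ i → subst₂ (Adj G′) (sym (suc-c′ _)) (sym (suc-c′ _)) (c-adj i))
                             , subst₂ (Adj G′) (sym (suc-c′ _)) (sym (suc-c′ _)) c-close)
      where
      0≢c : ∀ t → zero ≢ c t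
      0≢c t eq = c≢0 (t , sym eq)
      c′ : Fin (suc (suc (suc k))) → Fin m
      c′ t = punchOut (0≢c t)
      suc-c′ : ∀ t → suc (c′ t) ≡ c t
      suc-c′ t = punchIn-punchOut (0≢c t)
      c′-inj : Injective _≡_ _≡_ c′
      c′-inj {a} {b} eq = c-inj (trans (sym (suc-c′ a)) (trans (cong suc eq) (suc-c′ b)))

  addLeaf : SignedTree (suc m)
  addLeaf = record { graph = G′ ; connected = connected′ ; acyclic = acyclic′ }

  sdeg-addLeaf-leaf : sdeg addLeaf zero ≡ val (just s)
  sdeg-addLeaf-leaf = trans (ℤ.+-identityˡ _) (sumFin-val-edgeTo v s)

  sdeg-addLeaf-attached : sdeg addLeaf (suc v) ≡ val (just s) ℤ.+ sdeg T v
  sdeg-addLeaf-attached = cong (λ e → val e ℤ.+ sdeg T v) (edgeTo-self v s)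

  sdeg-addLeaf-other : ∀ {i} → i ≢ v → sdeg addLeaf (suc i) ≡ sdeg T i
  sdeg-addLeaf-other {i} i≢v =
    trans (cong (λ e → val e ℤ.+ sdeg T i) (edgeTo-other v s i≢v)) (ℤ.+-identityˡ (sdeg T i))

record PartialRealization (D P : ℤ → Set) (c m : ℕ) : Set where
  field
    tree        : SignedTree m
    root        : Fin m
    sdeg-root   : sdeg tree root ≡ + suc c
    sdeg-others : ∀ {v} → v ≢ root → D (sdeg tree v)
    attains     : ∀ {d} → P d → ∃ λ v → v ≢ root × sdeg tree v ≡ d

module _ {D : ℤ → Set} where

  weaken : ∀ {P P′ c m} → P′ ⊆ P → PartialRealization D P c m → PartialRealization D P′ c m
  weaken P′⊆P R = record { PartialRealization R; attains = attains ∘ P′⊆P }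
    where open PartialRealization R

  complete : ∀ {P m} → D 1ℤ → D ⊆ P → (R : PartialRealization D P 0 m) →
             Realizes D (PartialRealization.tree R)
  complete 1∈D D⊆P R = sdeg∈D , λ d d∈D → forgetRoot (attains (D⊆P d∈D))
    where
    open PartialRealization R
    sdeg∈D : ∀ v → D (sdeg tree v)
    sdeg∈D v with v ≟ᶠ root
    ... | yes refl   = subst D (sym sdeg-root) 1∈D
    ... | no  v≢root = sdeg-others v≢root
    forgetRoot : ∀ {d} → (∃ λ v → v ≢ root × sdeg tree v ≡ d) → ∃ λ v → sdeg tree v ≡ d
    forgetRoot (v , _ , eq) = v , eq

module _ {D : ℤ → Set} (1∈D : D 1ℤ) {P : ℤ → Set} where

  private
    module AttachAtRoot {c m} (R : PartialRealization D P c m) where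
      open PartialRealization R public
      tree′ = addLeaf tree root plus

      sdeg-leaf∈D : D (sdeg tree′ zero)
      sdeg-leaf∈D = subst D (sym (sdeg-addLeaf-leaf tree root plus)) 1∈D

      sdeg-root′ : sdeg tree′ (suc root) ≡ + suc (suc c)
      sdeg-root′ = trans (sdeg-addLeaf-attached tree root plus) (cong (λ i → 1ℤ ℤ.+ i) sdeg-root)

      sdeg-others′ : ∀ {i} → i ≢ root → D (sdeg tree′ (suc i))
      sdeg-others′ i≢root =
        subst D (sym (sdeg-addLeaf-other tree root plus i≢root)) (sdeg-others i≢root)

      attains′ : ∀ {d} → P d → ∃ λ i → i ≢ root × sdeg tree′ (suc i) ≡ d
      attains′ p with attains p
      ... | i , i≢root , eq = i , i≢root , trans (sdeg-addLeaf-other tree root plus i≢root) eq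

  growRoot : ∀ {c m} → PartialRealization D P c m → PartialRealization D P (suc c) (suc m)
  growRoot R = record
    { tree        = tree′
    ; root        = suc root
    ; sdeg-root   = sdeg-root′
    ; sdeg-others = others
    ; attains     = attains″
    }
    where
    open AttachAtRoot R
    others : ∀ {v} → v ≢ suc root → D (sdeg tree′ v)
    others {zero}  _      = sdeg-leaf∈D
    others {suc i} i≢root = sdeg-others′ (i≢root ∘ cong suc)
    attains″ : ∀ {d} → P d → ∃ λ v → v ≢ suc root × sdeg tree′ v ≡ d
    attains″ p with attains′ p
    ... | i , i≢root , eq = suc i , i≢root ∘ Fin-suc-injective , eq

  growRoot^ : ∀ y {m} → PartialRealization D P 0 m → PartialRealization D P y (y + m)
  growRoot^ zero    R = R
  growRoot^ (suc y) R = growRoot (growRoot^ y R)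

  moveRoot : ∀ {c m} → PartialRealization D P c m → D (+ suc (suc c)) →
             PartialRealization D (P ∪ (_≡ + suc (suc c))) 0 (suc m)
  moveRoot {c} R c+2∈D = record
    { tree        = tree′
    ; root        = zero
    ; sdeg-root   = sdeg-addLeaf-leaf tree root plus
    ; sdeg-others = others
    ; attains     = attains″
    }
    where
    open AttachAtRoot R
    others : ∀ {v} → v ≢ zero → D (sdeg tree′ v)
    others {zero}  0≢0 = ⊥-elim (0≢0 refl)
    others {suc i} _ with i ≟ᶠ root
    ... | yes refl   = subst D (sym sdeg-root′) c+2∈D
    ... | no  i≢root = sdeg-others′ i≢root
    attains″ : ∀ {d} → (P ∪ (_≡ + suc (suc c))) d → ∃ λ v → v ≢ zero × sdeg tree′ v ≡ d
    attains″ (inj₁ p) with attains′ p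
    ... | i , _ , eq = suc i , (λ ()) , eq
    attains″ (inj₂ refl) = suc root , (λ ()) , sdeg-root′

  addValue : ∀ {m} z → D z → 1ℤ < z → PartialRealization D P 0 m →
             PartialRealization D (P ∪ (_≡ z)) 0 (∣ z ∣ ∸ 1 + m)
  addValue (+ suc (suc y)) z∈D _         R = moveRoot (growRoot^ y R) z∈D
  addValue (+ 0)           _   (+<+ ())
  addValue (+ 1)           _   (+<+ (s≤s ()))
  addValue -[1+ _ ]        _   ()

addValues : ∀ {D : ℤ → Set} → D 1ℤ → ∀ {P m} k (z : Fin k → ℤ) →
            (∀ i → D (z i)) → (∀ i → 1ℤ < z i) → PartialRealization D P 0 m →
            PartialRealization D (P ∪ λ d → ∃ λ i → d ≡ z i) 0 (excess z + m)
addValues 1∈D zero    z _ _ R = weaken (λ { (inj₁ p) → p ; (inj₂ (() , _)) }) R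
addValues {D} 1∈D {P} {m} (suc k) z z∈D 1<z R =
  subst (PartialRealization D _ 0) (sym (+-assoc (∣ z zero ∣ ∸ 1) _ m))
    (weaken reassoc (addValue 1∈D (z zero) (z∈D zero) (1<z zero)
                              (addValues 1∈D k (z ∘ suc) (z∈D ∘ suc) (1<z ∘ suc) R)))
  where
  reassoc : (P ∪ λ d → ∃ λ i → d ≡ z i) ⊆ ((P ∪ λ d → ∃ λ i → d ≡ z (suc i)) ∪ (_≡ z zero))
  reassoc (inj₁ p)            = inj₁ (inj₁ p)
  reassoc (inj₂ (zero , eq))  = inj₂ eq
  reassoc (inj₂ (suc i , eq)) = inj₁ (inj₂ (i , eq))

edgeless : ∀ m → SignedGraph m
edgeless m = record { A = λ _ _ → nothing ; symm = λ _ _ → refl ; noLoop = λ _ → refl }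

singleton : SignedTree 1
singleton = record
  { graph     = edgeless 1
  ; connected = λ { zero zero → ε }
  ; acyclic   = λ { k c (_ , c-adj , _) → nothing≢just (proj₂ (c-adj zero)) }
  }
  where
  nothing≢just : ∀ {s : Sign} → ¬ nothing ≡ just s
  nothing≢just ()

path₄ : SignedTree 4
path₄ = addLeaf (addLeaf (addLeaf singleton zero plus) zero minus) zero plus

path₄-partial : ∀ {D} → D 0ℤ → D 1ℤ → PartialRealization D (λ d → d ≡ 1ℤ ⊎ d ≡ 0ℤ) 0 4
path₄-partial {D} 0∈D 1∈D = record
  { tree        = path₄
  ; root        = zero
  ; sdeg-root   = refl
  ; sdeg-others = others
  ; attains     = λ { (inj₁ refl) → suc (suc (suc zero)) , (λ ()) , refl
                    ; (inj₂ refl) → suc zero , (λ ()) , refl }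
  }
  where
  others : ∀ {v} → v ≢ zero → D (sdeg path₄ v)
  others {zero}                 0≢0 = ⊥-elim (0≢0 refl)
  others {suc zero}             _   = 0∈D
  others {suc (suc zero)}       _   = 0∈D
  others {suc (suc (suc zero))} _   = 1∈D

caterpillar : ∀ {n} (x : Fin n → ℤ) → (∀ i → 1ℤ < x i) →
              Σ (SignedTree (excess x + 4)) (Realizes (DSet x))
caterpillar {n} x 1<x = PartialRealization.tree R , complete (inj₁ refl) DSet⊆ R
  where
  R = addValues (inj₁ refl) n x (λ i → inj₂ (inj₂ (i , refl))) 1<x
                (path₄-partial (inj₂ (inj₁ refl)) (inj₁ refl))
  DSet⊆ : DSet x ⊆ ((λ d → d ≡ 1ℤ ⊎ d ≡ 0ℤ) ∪ λ d → ∃ λ i → d ≡ x i)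
  DSet⊆ (inj₁ d≡1)        = inj₁ (inj₁ d≡1)
  DSet⊆ (inj₂ (inj₁ d≡0)) = inj₁ (inj₂ d≡0)
  DSet⊆ (inj₂ (inj₂ d≡x)) = inj₂ d≡x

module _ {D : ℤ → Set} {m} (T : SignedTree m) (R : Realizes D T) where

  vertexOf : ∀ {d} → D d → Fin m
  vertexOf {d} d∈D = proj₁ (proj₂ R d d∈D)

  sdeg-vertexOf : ∀ {d} (d∈D : D d) → sdeg T (vertexOf d∈D) ≡ d
  sdeg-vertexOf {d} d∈D = proj₂ (proj₂ R d d∈D)

  vertexOf-injective : ∀ {d d′} (d∈D : D d) (d′∈D : D d′) → vertexOf d∈D ≡ vertexOf d′∈D → d ≡ d′
  vertexOf-injective d∈D d′∈D eq =
    trans (sym (sdeg-vertexOf d∈D)) (trans (cong (sdeg T) eq) (sdeg-vertexOf d′∈D))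

  realizes⇒1≤degree : ∀ {d d′} → D d → D d′ → d ≢ d′ → ∀ v → 1 ≤ degree (graph T) v
  realizes⇒1≤degree d∈D d′∈D d≢d′ = connected⇒1≤degree T (d≢d′ ∘ vertexOf-injective d∈D d′∈D)

module _ {n} {x : Fin n → ℤ} where

  DSet-nonnegative : (∀ i → 1ℤ < x i) → ∀ {d} → DSet x d → 0ℤ ℤ.≤ d
  DSet-nonnegative 1<x (inj₁ refl)              = +≤+ z≤n
  DSet-nonnegative 1<x (inj₂ (inj₁ refl))       = +≤+ z≤n
  DSet-nonnegative 1<x (inj₂ (inj₂ (i , refl))) = ℤ.<⇒≤ (ℤ.<-trans (+<+ (s≤s z≤n)) (1<x i))

  excess≤excess-sdeg : Injective _≡_ _≡_ x → ∀ {m} (T : SignedTree m) → Realizes (DSet x) T →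
                       excess x ≤ excess (sdeg T)
  excess≤excess-sdeg x-inj T R = begin
    excess x
      ≡⟨ sum-cong-≗ (cong (λ d → ∣ d ∣ ∸ 1) ∘ sdeg-vertexOf T R ∘ x∈D) ⟨
    sum (λ i → ∣ sdeg T (vertexOf T R (x∈D i)) ∣ ∸ 1)
      ≤⟨ sum-∘-injective-≤ (λ v → ∣ sdeg T v ∣ ∸ 1) vertexOf∘x∈D-injective ⟩
    excess (sdeg T) ∎
    where
    open ≤-Reasoning
    x∈D : ∀ i → DSet x (x i)
    x∈D i = inj₂ (inj₂ (i , refl))
    vertexOf∘x∈D-injective : Injective _≡_ _≡_ (vertexOf T R ∘ x∈D)
    vertexOf∘x∈D-injective eq = x-inj (vertexOf-injective T R (x∈D _) (x∈D _) eq)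

  realizes⇒2+excess+∑negDegree≤size : Injective _≡_ _≡_ x → (∀ i → 1ℤ < x i) →
    ∀ {m} (T : SignedTree m) → Realizes (DSet x) T → 2 + (excess x + sum (negDegree (graph T))) ≤ m
  realizes⇒2+excess+∑negDegree≤size x-inj 1<x {zero}  T R with proj₂ R 1ℤ (inj₁ refl)
  ... | () , _
  realizes⇒2+excess+∑negDegree≤size x-inj 1<x {suc M} T R =
    ≤-trans (+-monoʳ-≤ 2 (+-monoˡ-≤ _ (excess≤excess-sdeg x-inj T R)))
            (nonnegative⇒2+excess+∑negDegree≤size T
              (realizes⇒1≤degree T R (inj₁ refl) (inj₂ (inj₁ refl)) (λ ()))
              (DSet-nonnegative 1<x ∘ proj₁ R))

mainTheorem9 : (n : ℕ) → 1 ≤ n → (x : Fin n → ℤ) → Injective _≡_ _≡_ x → (∀ i → 1ℤ < x i)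
    → ∀ {m} (T : SignedTree m) → Optimal (DSet x) T → ExactlyOneNegEdge T
mainTheorem9 n _ x x-inj 1<x {m} T (R , optimal) =
  a , proj₁ negEdge , proj₂ negEdge , ∑negDegree≤2⇒minus-unique (graph T) ∑negDegree≤2 (proj₂ negEdge)
  where
  0∈D : DSet x 0ℤ
  0∈D = inj₂ (inj₁ refl)
  a = vertexOf T R 0∈D
  negEdge : ∃ λ b → A (graph T) a b ≡ just minus
  negEdge = sdeg≡0⇒∃minus T (sdeg-vertexOf T R 0∈D) (realizes⇒1≤degree T R (inj₁ refl) 0∈D (λ ()) a)
  X = excess x
  Q = sum (negDegree (graph T))
  ∑negDegree≤2 : Q ≤ 2
  ∑negDegree≤2 = +-cancelˡ-≤ (2 + X) Q 2 (begin
    2 + X + Q    ≡⟨ +-assoc 2 X Q ⟩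
    2 + (X + Q)  ≤⟨ realizes⇒2+excess+∑negDegree≤size x-inj 1<x T R ⟩
    m            ≤⟨ optimal _ (proj₁ (caterpillar x 1<x)) (proj₂ (caterpillar x 1<x)) ⟩
    X + 4        ≡⟨ +-comm X 4 ⟩
    2 + (2 + X)  ≡⟨ +-comm 2 (2 + X) ⟩
    2 + X + 2    ∎)
    where open ≤-Reasoning
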